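{- Let $G$ be a graph on $n$ nodes, let $k \in \left\{\left\lfloor \frac{n-1}{2}\right\rfloor, \ldots, n-2\right\}$ be an integer, let $\mathcal{L}$ be a left partial layout of $G$ with respect to bandwidth $k$, and for $0 \le j < n-k-1$ let \[A_j := \{v \in V(G) \setminus \operatorname{im}(\mathcal{L}) : \{\mathcal{L}(i), v\} \notin E(G) \text{ for all } 0 \le i \le j\}.\] Suppose $|A_j| \ge n-k-j-1$ for all $0 \le j < n-k-1$. Consider the procedure that, for $j = n-k-2, n-k-3, \ldots, 0$ in decreasing order, defines $\mathcal{R}(k+j+1)$ to be any node of $A_j$ not already selected at a previous step. Then at every step such a node exists, and the resulting map $\mathcal{R}$ is a right partial layout of $G$ with respect to bandwidth $k$ that is compatible with $\mathcal{L}$ and such that $(\mathcal{L}, \mathcal{R})$ is feasible.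
   Context: Graphs are unweighted, undirected, finite, with no self-loops. A layout of a graph $G$ on $n$ nodes is a bijection $\pi : V(G) \to \{0,1,\ldots,n-1\}$; the layout bandwidth $\beta_\pi(G)$ is the minimum non-negative integer $k$ such that $|\pi(u)-\pi(v)| \le k$ for every edge $\{u,v\}$. For $\left\lfloor \frac{n-1}{2}\right\rfloor \le k \le n-2$: a left partial layout (w.r.t. bandwidth $k$) is an injective map $\mathcal{L} : \{0,1,\ldots,n-k-2\} \to V(G)$; a right partial layout (w.r.t. bandwidth $k$) is an injective map $\mathcal{R} : \{k+1,\ldots,n-1\} \to V(G)$. $\mathcal{L}$ and $\mathcal{R}$ are compatible if $\operatorname{im}(\mathcal{L}) \cap \operatorname{im}(\mathcal{R}) = \emptyset$, equivalently if there is a layout $\pi$ with $\pi^{ -1}$ agreeing with $\mathcal{L}$ and $\mathcal{R}$ on their domains (such $\pi$ induces $\mathcal{L}$ and $\mathcal{R}$). A compatible pair $(\mathcal{L}, \mathcal{R})$ is feasible if $\beta_\pi(G) \le k$ for every layout $\pi$ inducing $\mathcal{L}$ and $\mathcal{R}$. -}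

module Defs where

open import Data.Bool using (Bool; true; false)
open import Data.Nat using (ℕ; suc; _+_; _∸_; _≤_; _<_; ∣_-_∣; _≤?_)
open import Data.Fin using (Fin; toℕ; _≟_)
open import Data.Fin.Properties using (any?; all?)
open import Data.Fin.Subset using (Subset)
open import Data.Vec using (tabulate)
open import Data.Product using (∃; _×_; _,_)
open import Relation.Nullary using (¬_; Dec; does)
open import Relation.Nullary.Decidable using (¬?; _×-dec_; _→-dec_)
open import Relation.Binary.PropositionalEquality using (_≡_; _≢_)
open import Data.Bool.Properties using () renaming (_≟_ to _≟ᵇ_)
open import Function.Bundles using (_⤖_; Bijection)

record Graph (n : ℕ) : Set where
  field
    adj   : Fin n → Fin n → Bool
    sym   : ∀ u v → adj u v ≡ adj v u
    loopless : ∀ v → adj v v ≡ false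

open Graph public

Edge : ∀ {n} → Graph n → Fin n → Fin n → Set
Edge G u v = adj G u v ≡ true

-- A layout: a bijection V(G) = Fin n → positions {0,…,n-1} = Fin n.
Layout : ℕ → Set
Layout n = Fin n ⤖ Fin n

pos : ∀ {n} → Layout n → Fin n → ℕ
pos π v = toℕ (Bijection.to π v)

BandwidthAtMost : ∀ {n} → Graph n → Layout n → ℕ → Set
BandwidthAtMost G π k = ∀ u v → Edge G u v → ∣ pos π u - pos π v ∣ ≤ k

-- Both domains have m = n - k - 1 elements:
--   a left partial layout L : {0,…,n-k-2} → V is represented by  L : Fin m → Fin n
--   (L i is the node at position toℕ i);
--   a right partial layout R : {k+1,…,n-1} → V is represented by R : Fin m → Fin n
--   (R j is the node at position k + 1 + toℕ j).
Injective : ∀ {m n} → (Fin m → Fin n) → Set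
Injective f = ∀ i j → f i ≡ f j → i ≡ j

IsLeftPartialLayout : ∀ {m n} → (Fin m → Fin n) → Set
IsLeftPartialLayout L = Injective L

IsRightPartialLayout : ∀ {m n} → (Fin m → Fin n) → Set
IsRightPartialLayout R = Injective R

Compatible : ∀ {m n} → (Fin m → Fin n) → (Fin m → Fin n) → Set
Compatible L R = ∀ i j → L i ≢ R j

Induces : ∀ {m n} → ℕ → Layout n → (Fin m → Fin n) → (Fin m → Fin n) → Set
Induces k π L R = (∀ i → pos π (L i) ≡ toℕ i) × (∀ j → pos π (R j) ≡ k + 1 + toℕ j)

Feasible : ∀ {m n} → Graph n → ℕ → (Fin m → Fin n) → (Fin m → Fin n) → Set
Feasible G k L R =
  Compatible L R × (∀ (π : Layout _) → Induces k π L R → BandwidthAtMost G π k)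

InA : ∀ {m n} → Graph n → (Fin m → Fin n) → Fin m → Fin n → Set
InA G L j v = (¬ ∃ λ i → L i ≡ v) × (∀ i → toℕ i ≤ toℕ j → ¬ Edge G (L i) v)

InA? : ∀ {m n} (G : Graph n) (L : Fin m → Fin n) (j : Fin m) (v : Fin n) → Dec (InA G L j v)
InA? G L j v =
  ¬? (any? λ i → L i ≟ v) ×-dec
  all? (λ i → (toℕ i ≤? toℕ j) →-dec ¬? (adj G (L i) v ≟ᵇ true))

A : ∀ {m n} → Graph n → (Fin m → Fin n) → Fin m → Subset n
A G L j = tabulate λ v → does (InA? G L j v)

{-# OPTIONS --safe #-}
module Submission where

-- Write m = n - k - 1. Step j only has to avoid the m - j - 1 nodes chosen at the steps j' > j,
-- and |A_j| ≥ m - j, so a node of A_j is always left. Membership in A_j also makes R(j) miss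
-- im(L). For feasibility, let {u, v} be an edge with π(u) + k + 1 ≤ π(v). Then π(v) ≥ k + 1 and
-- π(u) < m, so u = L(i) and v = R(j) with i = π(u) ≤ π(v) - k - 1 = j, and R(j) ∈ A_j forbids
-- that edge.

open import Defs
open import Data.Bool using (Bool; T)
open import Data.Bool.Properties using (T-≡)
open import Data.Fin using (Fin; zero; suc; toℕ; fromℕ<)
open import Data.Fin.Properties using (toℕ-injective; toℕ<n; toℕ-fromℕ<; suc-injective)
open import Data.Fin.Subset using (Subset; inside; outside; _∈_; ∣_∣; Nonempty; _-_)
open import Data.Fin.Subset.Properties using (∣p∣≤n; p─⊥≡p; p─q⊆p)
open import Data.Nat using (ℕ; suc; s≤s; _+_; _∸_; _≤_; _<_; _/_; _<ᵇ_)
open import Data.Nat.Properties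
  using ( ≤-reflexive; ≤-pred; ≤-trans; <-≤-trans; ≤-<-trans; ≤-total; ≮⇒≥; <⇒<ᵇ
        ; m≤n⇒m≤1+n; +-comm; ∸-+-assoc; ∸-monoˡ-<; m+n≤o⇒m≤o; m+n≤o⇒m≤o∸n; m≤o∸n⇒m+n≤o
        ; m+[n∸m]≡n; m≤n⇒∣m-n∣≡n∸m; m≤n⇒∣n-m∣≡n∸m )
open import Data.Product using (∃; _×_; _,_; proj₁; proj₂; map; map₂)
open import Data.Sum using (inj₁; inj₂)
open import Data.Vec using ([]; _∷_; here; there; tabulate)
open import Data.Vec.Properties using (lookup∘tabulate; lookup⇒[]=; []=⇒lookup)
open import Function using (_∘_)
open import Function.Bundles using (Bijection; Equivalence)
open import Relation.Nullary using (¬_; Dec; yes; does)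
open import Relation.Binary.PropositionalEquality as ≡
  using (_≡_; _≢_; ≢-sym; trans; cong; cong₂; subst; subst₂; module ≡-Reasoning)

private
  variable
    m n : ℕ

m∸n∸o≡m∸o∸n : ∀ m n o → m ∸ n ∸ o ≡ m ∸ o ∸ n
m∸n∸o≡m∸o∸n m n o = begin
  m ∸ n ∸ o   ≡⟨ ∸-+-assoc m n o ⟩
  m ∸ (n + o) ≡⟨ cong (m ∸_) (+-comm n o) ⟩
  m ∸ (o + n) ≡⟨ ∸-+-assoc m o n ⟨
  m ∸ o ∸ n   ∎
  where open ≡-Reasoning

x∈tabulate⁺ : ∀ (f : Fin n → Bool) {x} → T (f x) → x ∈ tabulate f
x∈tabulate⁺ f {x} fx = lookup⇒[]= x (tabulate f) (trans (lookup∘tabulate f x) (Equivalence.to T-≡ fx))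

x∈tabulate⁻ : ∀ (f : Fin n → Bool) {x} → x ∈ tabulate f → T (f x)
x∈tabulate⁻ f {x} x∈ = Equivalence.from T-≡ (trans (≡.sym (lookup∘tabulate f x)) ([]=⇒lookup x∈))

T-does⇒witness : ∀ {P : Set} (P? : Dec P) → T (does P?) → P
T-does⇒witness (yes p) _ = p

0<∣p∣⇒Nonempty : ∀ (p : Subset n) → 0 < ∣ p ∣ → Nonempty p
0<∣p∣⇒Nonempty (inside  ∷ p) _     = zero , here
0<∣p∣⇒Nonempty (outside ∷ p) 0<∣p∣ = map suc there (0<∣p∣⇒Nonempty p 0<∣p∣)

∣p∣≤1+∣p-x∣ : ∀ (p : Subset n) x → ∣ p ∣ ≤ suc ∣ (p - x) ∣
∣p∣≤1+∣p-x∣ (inside  ∷ p) zero    = s≤s (≤-reflexive (cong ∣_∣ (≡.sym (p─⊥≡p p))))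
∣p∣≤1+∣p-x∣ (outside ∷ p) zero    = m≤n⇒m≤1+n (≤-reflexive (cong ∣_∣ (≡.sym (p─⊥≡p p))))
∣p∣≤1+∣p-x∣ (inside  ∷ p) (suc x) = s≤s (∣p∣≤1+∣p-x∣ p x)
∣p∣≤1+∣p-x∣ (outside ∷ p) (suc x) = ∣p∣≤1+∣p-x∣ p x

x∈p-y⇒x≢y : ∀ {p : Subset n} {x y} → x ∈ p - y → x ≢ y
x∈p-y⇒x≢y {p = _ ∷ p} {zero}  {suc y} here        ()
x∈p-y⇒x≢y {p = _ ∷ p} {suc x} {zero}  (there x∈)  ()
x∈p-y⇒x≢y {p = _ ∷ p} {suc x} {suc y} (there x∈)  x≡y = x∈p-y⇒x≢y x∈ (suc-injective x≡y)

∃-∈-outside-image : ∀ (I : Subset m) (c : Fin m → Fin n) (S : Subset n) → ∣ I ∣ < ∣ S ∣ →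
                    ∃ λ v → v ∈ S × (∀ {i} → i ∈ I → c i ≢ v)
∃-∈-outside-image []            c S ∣I∣<∣S∣ = map₂ (_, λ ()) (0<∣p∣⇒Nonempty S ∣I∣<∣S∣)
∃-∈-outside-image (outside ∷ I) c S ∣I∣<∣S∣ with ∃-∈-outside-image I (c ∘ suc) S ∣I∣<∣S∣
... | v , v∈S , avoids = v , v∈S , λ { (there i∈I) → avoids i∈I }
∃-∈-outside-image (inside  ∷ I) c S ∣I∣<∣S∣
  with ∃-∈-outside-image I (c ∘ suc) (S - c zero) (≤-pred (≤-trans ∣I∣<∣S∣ (∣p∣≤1+∣p-x∣ S (c zero))))
... | v , v∈S-c₀ , avoids =
  v , p─q⊆p S _ v∈S-c₀ , λ { here → ≢-sym (x∈p-y⇒x≢y v∈S-c₀) ; (there i∈I) → avoids i∈I }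

above : Fin m → Subset m
above j = tabulate λ i → toℕ j <ᵇ toℕ i

j<i⇒i∈above : ∀ {j i : Fin m} → toℕ j < toℕ i → i ∈ above j
j<i⇒i∈above j<i = x∈tabulate⁺ _ (<⇒<ᵇ j<i)

∣above∣<m∸j : ∀ (j : Fin m) → ∣ above j ∣ < m ∸ toℕ j
∣above∣<m∸j {suc m} zero    = s≤s (∣p∣≤n (tabulate λ i → 0 <ᵇ suc (toℕ i)))
∣above∣<m∸j {suc m} (suc j) = ∣above∣<m∸j j

∃-∈-avoiding-later : ∀ (S : Subset n) (j : Fin m) (c : Fin m → Fin n) → m ∸ toℕ j ≤ ∣ S ∣ →
                     ∃ λ v → v ∈ S × (∀ j' → toℕ j < toℕ j' → c j' ≢ v)
∃-∈-avoiding-later S j c m-j≤∣S∣ =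
  map₂ (map₂ λ avoids j' j<j' → avoids (j<i⇒i∈above j<j'))
       (∃-∈-outside-image (above j) c S (<-≤-trans (∣above∣<m∸j j) m-j≤∣S∣))

module _ {n} (G : Graph n) {m} {L : Fin m → Fin n} {j : Fin m} {v : Fin n} where

  ∈A⇒InA : v ∈ A G L j → InA G L j v
  ∈A⇒InA v∈A = T-does⇒witness (InA? G L j v) (x∈tabulate⁻ _ v∈A)

  ∈A⇒∉image : v ∈ A G L j → ∀ i → L i ≢ v
  ∈A⇒∉image v∈A i Li≡v = proj₁ (∈A⇒InA v∈A) (i , Li≡v)

  ∈A⇒¬Edge : v ∈ A G L j → ∀ i → toℕ i ≤ toℕ j → ¬ Edge G (L i) v
  ∈A⇒¬Edge v∈A = proj₂ (∈A⇒InA v∈A)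

pos-injective : ∀ (π : Layout n) {u v} → pos π u ≡ pos π v → u ≡ v
pos-injective π = Bijection.injective π ∘ toℕ-injective

module _ {n k} (G : Graph n) (L : Fin (n ∸ k ∸ 1) → Fin n) {R : Fin (n ∸ k ∸ 1) → Fin n}
         (R∈A : ∀ j → R j ∈ A G L j) where

  module _ {π : Layout n} (π-induces : Induces k π L R) where

    no-edge-longer-than-k : ∀ {u v} → suc k + pos π u ≤ pos π v → ¬ Edge G u v
    no-edge-longer-than-k {u} {v} long uv =
      ∈A⇒¬Edge G (R∈A j) i i≤j (subst₂ (Edge G) (≡.sym Li≡u) (≡.sym Rj≡v) uv)
      where
      1+k≤v : suc k ≤ pos π v
      1+k≤v = m+n≤o⇒m≤o (suc k) long

      u≤v-1-k : pos π u ≤ pos π v ∸ suc k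
      u≤v-1-k = m+n≤o⇒m≤o∸n (pos π u) (subst (_≤ pos π v) (+-comm (suc k) (pos π u)) long)

      n∸[1+k]≡n∸k∸1 : n ∸ suc k ≡ n ∸ k ∸ 1
      n∸[1+k]≡n∸k∸1 = trans (≡.sym (∸-+-assoc n 1 k)) (m∸n∸o≡m∸o∸n n 1 k)

      v-1-k<n-k-1 : pos π v ∸ suc k < n ∸ k ∸ 1
      v-1-k<n-k-1 = subst (pos π v ∸ suc k <_) n∸[1+k]≡n∸k∸1
                          (∸-monoˡ-< (toℕ<n (Bijection.to π v)) 1+k≤v)

      i j : Fin (n ∸ k ∸ 1)
      i = fromℕ< (≤-<-trans u≤v-1-k v-1-k<n-k-1)
      j = fromℕ< v-1-k<n-k-1

      i≤j : toℕ i ≤ toℕ j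
      i≤j = subst₂ _≤_ (≡.sym (toℕ-fromℕ< _)) (≡.sym (toℕ-fromℕ< _)) u≤v-1-k

      Li≡u : L i ≡ u
      Li≡u = pos-injective π (trans (proj₁ π-induces i) (toℕ-fromℕ< _))

      Rj≡v : R j ≡ v
      Rj≡v = pos-injective π (begin
        pos π (R j)                ≡⟨ proj₂ π-induces j ⟩
        k + 1 + toℕ j              ≡⟨ cong₂ _+_ (+-comm k 1) (toℕ-fromℕ< _) ⟩
        suc k + (pos π v ∸ suc k)  ≡⟨ m+[n∸m]≡n 1+k≤v ⟩
        pos π v                    ∎)
        where open ≡-Reasoning

    edge-length≤k : ∀ {u v} → pos π u ≤ pos π v → Edge G u v → pos π v ∸ pos π u ≤ k
    edge-length≤k u≤v uv = ≮⇒≥ λ k<v-u → no-edge-longer-than-k (m≤o∸n⇒m+n≤o (suc k) u≤v k<v-u) uv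

    bandwidth≤k : BandwidthAtMost G π k
    bandwidth≤k u v uv with ≤-total (pos π u) (pos π v)
    ... | inj₁ u≤v = subst (_≤ k) (≡.sym (m≤n⇒∣m-n∣≡n∸m u≤v)) (edge-length≤k u≤v uv)
    ... | inj₂ v≤u = subst (_≤ k) (≡.sym (m≤n⇒∣n-m∣≡n∸m v≤u))
                           (edge-length≤k v≤u (trans (Graph.sym G v u) uv))

  compatible-feasible : Compatible L R × Feasible G k L R
  compatible-feasible = compatible , compatible , λ π π-induces → bandwidth≤k {π = π} π-induces
    where
    compatible : Compatible L R
    compatible i j = ∈A⇒∉image G (R∈A j) i

corollary3p3 : (n : ℕ) (G : Graph n) (k : ℕ) →
  (n ∸ 1) / 2 ≤ k → k ≤ n ∸ 2 →
  (L : Fin (n ∸ k ∸ 1) → Fin n) → IsLeftPartialLayout L →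
  (∀ j → n ∸ k ∸ toℕ j ∸ 1 ≤ ∣ A G L j ∣) →
  -- every step j of the procedure succeeds, whatever nodes c j' (j < j')
  -- were selected at the previous steps
  ((j : Fin (n ∸ k ∸ 1)) (c : Fin (n ∸ k ∸ 1) → Fin n) →
    (∀ j' → toℕ j < toℕ j' → c j' ∈ A G L j') →
    (∀ j₁ j₂ → toℕ j < toℕ j₁ → toℕ j < toℕ j₂ → c j₁ ≡ c j₂ → j₁ ≡ j₂) →
    ∃ λ v → v ∈ A G L j × (∀ j' → toℕ j < toℕ j' → c j' ≢ v))
  ×
  -- every complete run of the procedure (R j = ℛ(k + j + 1)) yields a
  -- right partial layout compatible with L and feasible together with L
  ((R : Fin (n ∸ k ∸ 1) → Fin n) →
    (∀ j → R j ∈ A G L j) →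
    (∀ j₁ j₂ → R j₁ ≡ R j₂ → j₁ ≡ j₂) →
    IsRightPartialLayout R × Compatible L R × Feasible G k L R)
corollary3p3 n G k _ _ L _ ∣Aⱼ∣≥ =
    (λ j c _ _ → ∃-∈-avoiding-later (A G L j) j c (m-j≤∣Aⱼ∣ j))
  , λ R R∈A R-injective → R-injective , compatible-feasible G L R∈A
  where
  m-j≤∣Aⱼ∣ : ∀ j → n ∸ k ∸ 1 ∸ toℕ j ≤ ∣ A G L j ∣
  m-j≤∣Aⱼ∣ j = subst (_≤ ∣ A G L j ∣) (m∸n∸o≡m∸o∸n (n ∸ k) (toℕ j) 1) (∣Aⱼ∣≥ j)
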